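{- Let $\ell\ge2$ be an integer. Then $\overline{\mathcal{V}}_\ell\cap[0,F_{\ell+3}]$ consists exactly of the 7 numbers \[F_\ell<F_{\ell+1}<F_{\ell+1}+F_{\ell-1}<F_{\ell+2}<F_{\ell+2}+F_{\ell-2}<F_{\ell+2}+F_\ell<F_{\ell+3}.\]
   Context: Fibonacci numbers: $F_{ -1}=0$, $F_0=1$, $F_{i+2}=F_{i+1}+F_i$; $\overline{\mathcal{F}}=\{F_i: i\ge-1\}$. Define $\bar\iota:\mathbb{N}\to\mathbb{N}$ by $\bar\iota(x)=x$ if $x\in\overline{\mathcal{F}}$, and $\bar\iota(x)=x-2F_{i-2}$ if $F_i<x<F_{i+1}$ for an integer $i\ge3$. Define $\bar\alpha(x)=\lim_{k\to\infty}\bar\iota^k(x)$. For $\ell\ge1$, $\overline{\mathcal{V}}_\ell=\{x\in\mathbb{N}: \bar\alpha(x)\ge F_\ell\}$. -}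

module Defs where

open import Data.Nat using (ℕ; zero; suc; _+_; _*_; _∸_; _≤_; _<_; _≤?_; _<?_)
open import Data.Product using (∃-syntax; _×_)
open import Relation.Nullary using (yes; no)
open import Relation.Nullary.Decidable using (_×-dec_)
open import Relation.Binary.PropositionalEquality using (_≡_)

-- Paper's Fibonacci numbers F_{-1} = 0, F_0 = 1, F_{i+2} = F_{i+1} + F_i.
-- F i is the paper's F_i for i ≥ 0; the index -1 (value 0) is handled
-- separately in InFibBar.
F : ℕ → ℕ
F zero = 1
F (suc zero) = 1
F (suc (suc i)) = F (suc i) + F i

InFibBar : ℕ → Set
InFibBar x = (x ≡ 0) ⊎' (∃[ i ] x ≡ F i)
  where
  open import Data.Sum renaming (_⊎_ to _⊎'_)

-- ῑ(x): if some i ≥ 3 has F_i < x < F_{i+1}, return x - 2 F_{i-2};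
-- otherwise (x ∈ 𝓕̄) return x.  Such an i necessarily satisfies i < x,
-- so the search over i = x-1, …, 0 is exhaustive (and the i is unique).
iotaSearch : ℕ → ℕ → ℕ
iotaSearch x zero = x
iotaSearch x (suc i) with (3 ≤? i) ×-dec ((F i <? x) ×-dec (x <? F (suc i)))
... | yes _ = x ∸ 2 * F (i ∸ 2)
... | no _  = iotaSearch x i

ιbar : ℕ → ℕ
ιbar x = iotaSearch x x

ιbar^ : ℕ → ℕ → ℕ
ιbar^ zero x = x
ιbar^ (suc k) x = ιbar (ιbar^ k x)

-- "lim_{k→∞} ῑ^k(x) = y" (limit of a sequence of naturals = eventually constant)
ᾱ-is : ℕ → ℕ → Set
ᾱ-is x y = ∃[ K ] (∀ k → K ≤ k → ιbar^ k x ≡ y)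

InV : ℕ → ℕ → Set
InV ℓ x = ∃[ y ] (ᾱ-is x y × F ℓ ≤ y)

{-# OPTIONS --safe #-}
module Submission where

-- ῑ fixes every Fibonacci number and translates the gap (F_i, F_{i+1}) down by
-- 2F_{i-2}, which lands strictly below F_i.  Since ῑ never increases its
-- argument, ᾱ(x) ≥ F_ℓ iff ᾱ(ῑ x) ≥ F_ℓ, and every x < F_ℓ fails.  Going up
-- gap by gap: nothing in (F_ℓ, F_{ℓ+1}) survives; in (F_{ℓ+1}, F_{ℓ+2}) only
-- the translate F_ℓ + 2F_{ℓ-1} of the survivor F_ℓ; in (F_{ℓ+2}, F_{ℓ+3}) only
-- the translates by 2F_ℓ of the survivors F_ℓ and F_{ℓ+1} (that of the third
-- survivor F_{ℓ+1} + F_{ℓ-1} is F_{ℓ+3} itself).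

open import Defs
open import Data.Nat using (ℕ; zero; suc; _+_; _*_; _∸_; _≤_; _<_; _≤′_; ≤′-refl; ≤′-step;
  z≤n; s≤s; _≤?_; _<?_)
open import Data.Nat.Properties
open import Data.Nat.Tactic.RingSolver using (solve-∀)
open import Data.Product using (_×_; _,_)
open import Data.Sum using (inj₁; inj₂)
open import Data.Empty using (⊥; ⊥-elim)
open import Data.List using (List; _∷_; []; _++_)
open import Data.List.Relation.Unary.Any using (here; there)
open import Data.List.Membership.Propositional using (_∈_)
open import Data.List.Membership.Propositional.Properties using (∈-++⁺ˡ; ∈-++⁺ʳ)
open import Function.Bundles using (_⇔_; mk⇔; module Equivalence)
open Equivalence using (to; from)
open import Relation.Nullary using (yes; no)
open import Relation.Nullary.Decidable using (_×-dec_)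
open import Relation.Binary.Definitions using (tri<; tri≈; tri>)
open import Relation.Binary.PropositionalEquality
open ≡-Reasoning

F-positive : ∀ n → 1 ≤ F n
F-positive zero = s≤s z≤n
F-positive (suc zero) = s≤s z≤n
F-positive (suc (suc n)) = ≤-trans (F-positive (suc n)) (m≤m+n (F (suc n)) (F n))

F-≤-suc : ∀ n → F n ≤ F (suc n)
F-≤-suc zero = ≤-refl
F-≤-suc (suc n) = m≤m+n (F (suc n)) (F n)

F-mono-≤′ : ∀ {m n} → m ≤′ n → F m ≤ F n
F-mono-≤′ ≤′-refl = ≤-refl
F-mono-≤′ {n = suc n} (≤′-step m≤′n) = ≤-trans (F-mono-≤′ m≤′n) (F-≤-suc n)

F-mono-≤ : ∀ {m n} → m ≤ n → F m ≤ F n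
F-mono-≤ m≤n = F-mono-≤′ (≤⇒≤′ m≤n)

n≤F[n] : ∀ n → n ≤ F n
n≤F[n] zero = z≤n
n≤F[n] (suc zero) = ≤-refl
n≤F[n] (suc (suc n)) =
  subst (_≤ F (suc (suc n))) (+-comm (suc n) 1) (+-mono-≤ (n≤F[n] (suc n)) (F-positive n))

F[2+n]≤2*F[1+n] : ∀ n → F (2 + n) ≤ 2 * F (1 + n)
F[2+n]≤2*F[1+n] n =
  subst (F (2 + n) ≤_) (cong (F (1 + n) +_) (sym (+-identityʳ (F (1 + n)))))
        (+-monoʳ-≤ (F (1 + n)) (F-≤-suc n))

2*F[1+n]≤F[3+n] : ∀ n → 2 * F (1 + n) ≤ F (3 + n)
2*F[1+n]≤F[3+n] n =
  subst (_≤ F (3 + n)) (cong (F (1 + n) +_) (sym (+-identityʳ (F (1 + n)))))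
        (subst (_≤ F (3 + n)) (+-comm (F (1 + n)) (F (1 + n)))
               (+-monoˡ-≤ (F (1 + n)) (F-≤-suc (1 + n))))

F-gap-unique : ∀ {i j x} → F i < x → x < F (suc i) → F j < x → x < F (suc j) → i ≡ j
F-gap-unique {i} {j} Fi<x x<Fi' Fj<x x<Fj' with <-cmp i j
... | tri≈ _ i≡j _ = i≡j
... | tri< i<j _ _ = ⊥-elim (<-asym x<Fi' (≤-<-trans (F-mono-≤ i<j) Fj<x))
... | tri> _ _ j<i = ⊥-elim (<-asym x<Fj' (≤-<-trans (F-mono-≤ j<i) Fi<x))

F-not-in-gap : ∀ i j → F i < F j → F j < F (suc i) → ⊥
F-not-in-gap i j Fi<Fj Fj<Fi' with i <? j
... | yes i<j = <⇒≱ Fj<Fi' (F-mono-≤ i<j)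
... | no i≮j = <⇒≱ Fi<Fj (F-mono-≤ (≮⇒≥ i≮j))

iotaSearch-≤ : ∀ x n → iotaSearch x n ≤ x
iotaSearch-≤ x zero = ≤-refl
iotaSearch-≤ x (suc n) with (3 ≤? n) ×-dec ((F n <? x) ×-dec (x <? F (suc n)))
... | yes _ = m∸n≤m x (2 * F (n ∸ 2))
... | no _ = iotaSearch-≤ x n

iotaSearch-outside-gaps : ∀ x n → (∀ i → F i < x → x < F (suc i) → ⊥) → iotaSearch x n ≡ x
iotaSearch-outside-gaps x zero _ = refl
iotaSearch-outside-gaps x (suc n) no-gap with (3 ≤? n) ×-dec ((F n <? x) ×-dec (x <? F (suc n)))
... | yes (_ , Fn<x , x<Fn') = ⊥-elim (no-gap n Fn<x x<Fn')
... | no _ = iotaSearch-outside-gaps x n no-gap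

iotaSearch-in-gap : ∀ {x i} → 3 ≤ i → F i < x → x < F (suc i) →
                    ∀ n → i < n → iotaSearch x n ≡ x ∸ 2 * F (i ∸ 2)
iotaSearch-in-gap {x} {i} 3≤i Fi<x x<Fi' (suc n) (s≤s i≤n)
  with (3 ≤? n) ×-dec ((F n <? x) ×-dec (x <? F (suc n)))
... | yes (_ , Fn<x , x<Fn') =
  cong (λ k → x ∸ 2 * F (k ∸ 2)) (F-gap-unique {n} {i} Fn<x x<Fn' Fi<x x<Fi')
... | no ¬gap = iotaSearch-in-gap {x} {i} 3≤i Fi<x x<Fi' n (≤∧≢⇒< i≤n i≢n)
  where
  i≢n : i ≢ n
  i≢n refl = ¬gap (3≤i , Fi<x , x<Fi')

ιbar-≤ : ∀ x → ιbar x ≤ x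
ιbar-≤ x = iotaSearch-≤ x x

ιbar-F : ∀ j → ιbar (F j) ≡ F j
ιbar-F j = iotaSearch-outside-gaps (F j) (F j) (λ i → F-not-in-gap i j)

ιbar-gap : ∀ j {x} → F (3 + j) < x → x < F (4 + j) → ιbar x + 2 * F (1 + j) ≡ x
ιbar-gap j {x} F3<x x<F4 = begin
  ιbar x + 2 * F (1 + j)            ≡⟨ cong (_+ 2 * F (1 + j)) ιbar-x ⟩
  x ∸ 2 * F (1 + j) + 2 * F (1 + j) ≡⟨ m∸n+n≡m (≤-trans (2*F[1+n]≤F[3+n] j) (<⇒≤ F3<x)) ⟩
  x                                 ∎
  where
  ιbar-x : ιbar x ≡ x ∸ 2 * F (1 + j)
  ιbar-x = iotaSearch-in-gap (s≤s (s≤s (s≤s z≤n))) F3<x x<F4 x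
             (≤-<-trans (n≤F[n] (3 + j)) F3<x)

ιbar-gap-≡ : ∀ j {x t} → F (3 + j) < x → x < F (4 + j) → ιbar x ≡ t ⇔ x ≡ t + 2 * F (1 + j)
ιbar-gap-≡ j {x} {t} F3<x x<F4 = mk⇔
  (λ ιbar-x≡t → trans (sym (ιbar-gap j F3<x x<F4)) (cong (_+ 2 * F (1 + j)) ιbar-x≡t))
  (λ x≡t+2F → +-cancelʳ-≡ (2 * F (1 + j)) (ιbar x) t (trans (ιbar-gap j F3<x x<F4) x≡t+2F))

ιbar-gap-< : ∀ i {x} → F i < x → x < F (suc i) → ιbar x < F i
ιbar-gap-< zero F0<x x<F1 = ⊥-elim (<-asym F0<x x<F1)
ιbar-gap-< (suc zero) F1<x x<F2 = ⊥-elim (≤⇒≯ F1<x x<F2)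
ιbar-gap-< (suc (suc zero)) F2<x x<F3 = ⊥-elim (≤⇒≯ F2<x x<F3)
ιbar-gap-< (suc (suc (suc j))) {x} F3<x x<F4 =
  +-cancelʳ-< (2 * F (1 + j)) (ιbar x) (F (3 + j))
    (subst (_< F (3 + j) + 2 * F (1 + j)) (sym (ιbar-gap j F3<x x<F4))
           (<-≤-trans x<F4 (+-monoʳ-≤ (F (3 + j)) (F[2+n]≤2*F[1+n] j))))

ιbar^-suc : ∀ k x → ιbar^ (suc k) x ≡ ιbar^ k (ιbar x)
ιbar^-suc zero x = refl
ιbar^-suc (suc k) x = cong ιbar (ιbar^-suc k x)

ιbar^-≤ : ∀ k x → ιbar^ k x ≤ x
ιbar^-≤ zero x = ≤-refl
ιbar^-≤ (suc k) x = ≤-trans (ιbar-≤ _) (ιbar^-≤ k x)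

ᾱ-is-≤ : ∀ {x y} → ᾱ-is x y → y ≤ x
ᾱ-is-≤ {x} (K , lim) = subst (_≤ x) (lim K ≤-refl) (ιbar^-≤ K x)

ᾱ-is-fixed : ∀ {z} → ιbar z ≡ z → ᾱ-is z z
ᾱ-is-fixed {z} ιbar-z = 0 , λ k _ → ιbar^-fixed k
  where
  ιbar^-fixed : ∀ k → ιbar^ k z ≡ z
  ιbar^-fixed zero = refl
  ιbar^-fixed (suc k) = trans (cong ιbar (ιbar^-fixed k)) ιbar-z

ᾱ-is-ιbar⁺ : ∀ {x y} → ᾱ-is x y → ᾱ-is (ιbar x) y
ᾱ-is-ιbar⁺ {x} (K , lim) = K , λ k K≤k → trans (sym (ιbar^-suc k x)) (lim (suc k) (m≤n⇒m≤1+n K≤k))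

ᾱ-is-ιbar⁻ : ∀ {x y} → ᾱ-is (ιbar x) y → ᾱ-is x y
ᾱ-is-ιbar⁻ {x} (K , lim) = suc K , λ { (suc k) (s≤s K≤k) → trans (ιbar^-suc k x) (lim k K≤k) }

InV⇒F≤ : ∀ ℓ {x} → InV ℓ x → F ℓ ≤ x
InV⇒F≤ _ (y , lim , Fℓ≤y) = ≤-trans Fℓ≤y (ᾱ-is-≤ lim)

InV-F : ∀ {ℓ j} → ℓ ≤ j → InV ℓ (F j)
InV-F {j = j} ℓ≤j = F j , ᾱ-is-fixed (ιbar-F j) , F-mono-≤ ℓ≤j

InV-ιbar⁺ : ∀ ℓ {x} → InV ℓ x → InV ℓ (ιbar x)
InV-ιbar⁺ _ (y , lim , Fℓ≤y) = y , ᾱ-is-ιbar⁺ lim , Fℓ≤y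

InV-ιbar⁻ : ∀ ℓ {x} → InV ℓ (ιbar x) → InV ℓ x
InV-ιbar⁻ _ (y , lim , Fℓ≤y) = y , ᾱ-is-ιbar⁻ lim , Fℓ≤y

InV-ιbar-F : ∀ {ℓ j x} → ℓ ≤ j → ιbar x ≡ F j → InV ℓ x
InV-ιbar-F {ℓ} ℓ≤j ιbar-x = InV-ιbar⁻ ℓ (subst (InV ℓ) (sym ιbar-x) (InV-F ℓ≤j))

-- ℓ = 2 + m, so that F (ℓ ∸ 1) and F (ℓ ∸ 2) are F (1 + m) and F m.
module Classification (m : ℕ) where

  V₁ V₂ V₃ V : List ℕ
  V₁ = F (2 + m) ∷ []
  V₂ = V₁ ++ F (3 + m) ∷ F (3 + m) + F (1 + m) ∷ []
  V₃ = V₂ ++ F (4 + m) ∷ F (4 + m) + F m ∷ F (4 + m) + F (2 + m) ∷ []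
  V = V₃ ++ F (5 + m) ∷ []

  V-ascending : F (2 + m) < F (3 + m)
              × F (3 + m) < F (3 + m) + F (1 + m)
              × F (3 + m) + F (1 + m) < F (4 + m)
              × F (4 + m) < F (4 + m) + F m
              × F (4 + m) + F m < F (4 + m) + F (2 + m)
              × F (4 + m) + F (2 + m) < F (5 + m)
  V-ascending = m<m+n _ (F-positive (1 + m))
              , m<m+n _ (F-positive (1 + m))
              , +-monoʳ-< (F (3 + m)) (m<m+n _ (F-positive m))
              , m<m+n _ (F-positive m)
              , +-monoʳ-< (F (4 + m)) (m<n+m _ (F-positive (1 + m)))
              , +-monoʳ-< (F (4 + m)) (m<m+n _ (F-positive (1 + m)))

  F[3+m]+F[1+m]≡F[2+m]+2*F[1+m] : F (3 + m) + F (1 + m) ≡ F (2 + m) + 2 * F (1 + m)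
  F[3+m]+F[1+m]≡F[2+m]+2*F[1+m] = identity (F m) (F (1 + m))
    where
    identity : ∀ a b → ((b + a) + b) + b ≡ (b + a) + 2 * b
    identity = solve-∀

  F[4+m]+F[m]≡F[2+m]+2*F[2+m] : F (4 + m) + F m ≡ F (2 + m) + 2 * F (2 + m)
  F[4+m]+F[m]≡F[2+m]+2*F[2+m] = identity (F m) (F (1 + m))
    where
    identity : ∀ a b → (((b + a) + b) + (b + a)) + a ≡ (b + a) + 2 * (b + a)
    identity = solve-∀

  F[4+m]+F[2+m]≡F[3+m]+2*F[2+m] : F (4 + m) + F (2 + m) ≡ F (3 + m) + 2 * F (2 + m)
  F[4+m]+F[2+m]≡F[3+m]+2*F[2+m] = identity (F m) (F (1 + m))
    where
    identity : ∀ a b → (((b + a) + b) + (b + a)) + (b + a) ≡ ((b + a) + b) + 2 * (b + a)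
    identity = solve-∀

  F[3+m]+F[1+m]+2*F[2+m]≡F[5+m] : F (3 + m) + F (1 + m) + 2 * F (2 + m) ≡ F (5 + m)
  F[3+m]+F[1+m]+2*F[2+m]≡F[5+m] = identity (F m) (F (1 + m))
    where
    identity : ∀ a b → ((b + a) + b) + b + 2 * (b + a)
                     ≡ (((b + a) + b) + (b + a)) + ((b + a) + b)
    identity = solve-∀

  InV⇒∈V₁ : ∀ {x} → x < F (3 + m) → InV (2 + m) x → x ∈ V₁
  InV⇒∈V₁ {x} x<F3 inv with <-cmp x (F (2 + m))
  ... | tri< x<F2 _ _ = ⊥-elim (<⇒≱ x<F2 (InV⇒F≤ (2 + m) inv))
  ... | tri≈ _ x≡F2 _ = here x≡F2
  ... | tri> _ _ F2<x =
    ⊥-elim (<⇒≱ (ιbar-gap-< (2 + m) F2<x x<F3) (InV⇒F≤ (2 + m) (InV-ιbar⁺ (2 + m) inv)))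

  InV⇒∈V₂ : ∀ {x} → x < F (4 + m) → InV (2 + m) x → x ∈ V₂
  InV⇒∈V₂ {x} x<F4 inv with <-cmp x (F (3 + m))
  ... | tri< x<F3 _ _ = ∈-++⁺ˡ (InV⇒∈V₁ x<F3 inv)
  ... | tri≈ _ x≡F3 _ = ∈-++⁺ʳ V₁ (here x≡F3)
  ... | tri> _ _ F3<x with InV⇒∈V₁ (ιbar-gap-< (3 + m) F3<x x<F4) (InV-ιbar⁺ (2 + m) inv)
  ...   | here ιbar-x≡F2 = ∈-++⁺ʳ V₁ (there (here
          (trans (to (ιbar-gap-≡ m F3<x x<F4) ιbar-x≡F2) (sym F[3+m]+F[1+m]≡F[2+m]+2*F[1+m]))))

  InV⇒∈V₃ : ∀ {x} → x < F (5 + m) → InV (2 + m) x → x ∈ V₃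
  InV⇒∈V₃ {x} x<F5 inv with <-cmp x (F (4 + m))
  ... | tri< x<F4 _ _ = ∈-++⁺ˡ (InV⇒∈V₂ x<F4 inv)
  ... | tri≈ _ x≡F4 _ = ∈-++⁺ʳ V₂ (here x≡F4)
  ... | tri> _ _ F4<x with InV⇒∈V₂ (ιbar-gap-< (4 + m) F4<x x<F5) (InV-ιbar⁺ (2 + m) inv)
  ...   | here ιbar-x≡F2 = ∈-++⁺ʳ V₂ (there (here
          (trans (to (ιbar-gap-≡ (suc m) F4<x x<F5) ιbar-x≡F2) (sym F[4+m]+F[m]≡F[2+m]+2*F[2+m]))))
  ...   | there (here ιbar-x≡F3) = ∈-++⁺ʳ V₂ (there (there (here
          (trans (to (ιbar-gap-≡ (suc m) F4<x x<F5) ιbar-x≡F3) (sym F[4+m]+F[2+m]≡F[3+m]+2*F[2+m])))))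
  ...   | there (there (here ιbar-x≡F3+F1)) = ⊥-elim (<-irrefl
          (trans (to (ιbar-gap-≡ (suc m) F4<x x<F5) ιbar-x≡F3+F1) F[3+m]+F[1+m]+2*F[2+m]≡F[5+m]) x<F5)

  InV⇒∈V : ∀ {x} → x ≤ F (5 + m) → InV (2 + m) x → x ∈ V
  InV⇒∈V x≤F5 inv with m≤n⇒m<n∨m≡n x≤F5
  ... | inj₁ x<F5 = ∈-++⁺ˡ (InV⇒∈V₃ x<F5 inv)
  ... | inj₂ x≡F5 = ∈-++⁺ʳ V₃ (here x≡F5)

  ∈V⇒InV : ∀ {x} → x ∈ V → InV (2 + m) x
  ∈V⇒InV with V-ascending
  ... | F2<F3 , F3<F3+F1 , F3+F1<F4 , F4<F4+F0 , F4+F0<F4+F2 , F4+F2<F5 = λ where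
    (here refl) → InV-F (≤-refl {2 + m})
    (there (here refl)) → InV-F (n≤1+n (2 + m))
    (there (there (here refl))) → InV-ιbar-F (≤-refl {2 + m})
      (from (ιbar-gap-≡ m F3<F3+F1 F3+F1<F4) F[3+m]+F[1+m]≡F[2+m]+2*F[1+m])
    (there (there (there (here refl)))) → InV-F (m≤n+m (2 + m) 2)
    (there (there (there (there (here refl))))) → InV-ιbar-F (≤-refl {2 + m})
      (from (ιbar-gap-≡ (suc m) F4<F4+F0 (<-trans F4+F0<F4+F2 F4+F2<F5)) F[4+m]+F[m]≡F[2+m]+2*F[2+m])
    (there (there (there (there (there (here refl)))))) → InV-ιbar-F (n≤1+n (2 + m))
      (from (ιbar-gap-≡ (suc m) (<-trans F4<F4+F0 F4+F0<F4+F2) F4+F2<F5) F[4+m]+F[2+m]≡F[3+m]+2*F[2+m])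
    (there (there (there (there (there (there (here refl))))))) → InV-F (m≤n+m (2 + m) 3)

lemma4p4 : (ℓ : ℕ) → 2 ≤ ℓ →
    (F ℓ < F (ℓ + 1)
      × F (ℓ + 1) < F (ℓ + 1) + F (ℓ ∸ 1)
      × F (ℓ + 1) + F (ℓ ∸ 1) < F (ℓ + 2)
      × F (ℓ + 2) < F (ℓ + 2) + F (ℓ ∸ 2)
      × F (ℓ + 2) + F (ℓ ∸ 2) < F (ℓ + 2) + F ℓ
      × F (ℓ + 2) + F ℓ < F (ℓ + 3))
    × ((x : ℕ) → x ≤ F (ℓ + 3) →
        (InV ℓ x ⇔ x ∈ (F ℓ ∷ F (ℓ + 1) ∷ F (ℓ + 1) + F (ℓ ∸ 1) ∷ F (ℓ + 2)
                        ∷ F (ℓ + 2) + F (ℓ ∸ 2) ∷ F (ℓ + 2) + F ℓ ∷ F (ℓ + 3) ∷ [])))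
lemma4p4 (suc zero) (s≤s ())
lemma4p4 (suc (suc m)) _ rewrite +-comm m 1 | +-comm m 2 | +-comm m 3 =
  V-ascending , λ x x≤F5 → mk⇔ (InV⇒∈V x≤F5) ∈V⇒InV
  where open Classification m
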